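{- Let $\Gamma$ be a strongly regular graph of type II with parameters $(v,k,\lambda,\mu)$, $\mu>0$, and restricted eigenvalues $\rho>\sigma$; let $d$ be an integer with $0\le d\le k$ and $h_d=v\frac{d-\sigma}{k-\sigma}$. Suppose $$0<\mathrm{frac}(h_d)<\frac{(k-\sigma)-(d-\sigma)(\rho-\sigma)}{\mu}.$$ Then $\mathrm{Rab}_{\geq}(\Gamma,d)<\lfloor h_d\rfloor$.
   Context: A graph is strongly regular with parameters $(v,k,\lambda,\mu)$ if it has $v$ vertices, is $k$-regular, is neither complete nor edgeless, every two adjacent vertices have exactly $\lambda$ common neighbours, and every two distinct non-adjacent vertices have exactly $\mu$ common neighbours. Its restricted eigenvalues $\rho>\sigma$ are the roots of $t^2-(\lambda-\mu)t-(k-\mu)=0$; it is of type II if all its eigenvalues are integers. For real $x$, $\mathrm{frac}(x)=x-\lfloor x\rfloor$. $R_\Gamma(x,y,d)=x(x+1)(v-y)-2xyk+(2x+\lambda-\mu+1)yd+y(y-1)\mu-yd^2$; $S_d=\{y\in\{d+1,\dots,v\}: R_\Gamma(x,y,d)\ge0\text{ for all integers }x\}$; $\mathrm{Rab}_{\geq}(\Gamma,d)=\max S_d$ if $S_d\ne\emptyset$, else $0$. -}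

module Defs where

open import Data.Nat as ℕ using (ℕ)
open import Data.Integer as ℤ using (ℤ; +_)
open import Data.Rational as ℚ using (ℚ; 0ℚ)
open import Data.Rational.Properties using () renaming (_≟_ to _≟ℚ_)
open import Data.Fin using (Fin)
open import Data.List using (List; length; filter)
open import Data.List using () renaming (allFin to allFinL)
open import Data.Product using (_×_; ∃-syntax; _,_)
open import Data.Sum using (_⊎_)
open import Relation.Nullary using (¬_; yes; no)
open import Relation.Nullary.Decidable using (_×-dec_)
open import Relation.Binary.PropositionalEquality using (_≡_; _≢_)

record Graph (n : ℕ) : Set₁ where
  field
    Adj    : Fin n → Fin n → Set
    adj?   : (u w : Fin n) → Relation.Nullary.Dec (Adj u w)
    sym    : ∀ {u w} → Adj u w → Adj w u
    irrefl : ∀ {u} → ¬ Adj u u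

  degree : Fin n → ℕ
  degree u = length (filter (adj? u) (allFinL n))

  common : Fin n → Fin n → ℕ
  common u w = length (filter (λ z → adj? u z ×-dec adj? w z) (allFinL n))

open Relation.Nullary using (Dec) public

record IsSRG {v : ℕ} (Γ : Graph v) (k lam mu : ℕ) : Set where
  open Graph Γ
  field
    regular      : ∀ u → degree u ≡ k
    notComplete  : ∃[ u ] ∃[ w ] (u ≢ w × ¬ Adj u w)
    notEdgeless  : ∃[ u ] ∃[ w ] Adj u w
    adjCommon    : ∀ u w → Adj u w → common u w ≡ lam
    nonadjCommon : ∀ u w → u ≢ w → ¬ Adj u w → common u w ≡ mu

IsRestrictedRoot : (k lam mu : ℕ) → ℤ → Set
IsRestrictedRoot k lam mu t =
  t ℤ.* t ℤ.- (+ lam ℤ.- + mu) ℤ.* t ℤ.- (+ k ℤ.- + mu) ≡ + 0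

-- total division on ℚ (division by 0 gives 0; only used with nonzero divisors)
_÷′_ : ℚ → ℚ → ℚ
p ÷′ q with q ≟ℚ 0ℚ
... | yes _ = 0ℚ
... | no q≢0 = ℚ._÷_ p q {{ℚ.≢-nonZero q≢0}}

frac : ℚ → ℚ
frac p = p ℚ.- (ℚ.floor p ℚ./ 1)

hd : (v k d : ℕ) (σ : ℤ) → ℚ
hd v k d σ = (+ v ℤ.* (+ d ℤ.- σ) ℚ./ 1) ÷′ ((+ k ℤ.- σ) ℚ./ 1)

R : (v k lam mu : ℕ) → ℤ → ℕ → ℕ → ℤ
R v k lam mu x y d =
  x ℤ.* (x ℤ.+ + 1) ℤ.* (+ v ℤ.- + y)
  ℤ.- + 2 ℤ.* x ℤ.* + y ℤ.* + k
  ℤ.+ (+ 2 ℤ.* x ℤ.+ + lam ℤ.- + mu ℤ.+ + 1) ℤ.* + y ℤ.* + d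
  ℤ.+ + y ℤ.* (+ y ℤ.- + 1) ℤ.* + mu
  ℤ.- + y ℤ.* + d ℤ.* + d

InS : (v k lam mu d : ℕ) → ℕ → Set
InS v k lam mu d y = d ℕ.< y × y ℕ.≤ v × (∀ (x : ℤ) → + 0 ℤ.≤ R v k lam mu x y d)

-- r = Rab_≥(Γ,d)  (max S_d if S_d ≠ ∅, else 0)
IsRab : (v k lam mu d : ℕ) → ℕ → Set
IsRab v k lam mu d r =
  ((∀ y → ¬ InS v k lam mu d y) × r ≡ 0)
  ⊎ (InS v k lam mu d r × (∀ y → InS v k lam mu d y → y ℕ.≤ r))

module Submission where

-- With K = k - σ, the counting identity μ(v - k - 1) = k(k - λ - 1) of a strongly regular graph
-- becomes μv = K(k - ρ), so h_d = v(d - σ)/K = H/μ with H = (d - σ)(k - ρ). Writing q = ⌊h_d⌋,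
-- the hypothesis on frac(h_d) says exactly that μq < H and H - μq < K - (d - σ)(ρ - σ), and
-- H ≥ μ gives q ≥ 1. Every y ∈ S_d lies below q: at y = q, μ·R(d - σ - 1, q, d) is minus the
-- product of these two positive gaps; for q < y < v, completing the square in x gives
-- 4μ(v - y)R(x, y, d) ≤ -4y(μy - H)(μy - H + (ρ - σ)(k - d)) < 0 for x near y(k - d)/(v - y);
-- and R(x, v, d) is linear in x with negative slope because d < k (d = k would make h_d = v).

open import Defs
open import Data.Nat as ℕ using (ℕ)
open import Data.Integer as ℤ using (ℤ; +_)
open import Data.Rational as ℚ using (ℚ; 0ℚ)
open import Data.Product using (_×_; _,_; ∃-syntax; proj₁; proj₂)
open import Data.Sum using (inj₁; inj₂)
open import Data.Empty using (⊥)
open import Function using (_∘_)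
open import Relation.Nullary using (Dec; does; yes; no; ¬_; contradiction)
open import Relation.Binary.Definitions using (tri<; tri≈; tri>)
open import Relation.Binary.PropositionalEquality

-- Counting in strongly regular graphs

module Counting where

  open import Data.Bool.Base using (if_then_else_)
  open import Data.Nat using (zero; suc; _+_; _*_; _≤_; _<_; z≤n)
  import Data.Nat.Properties as ℕP
  open import Data.Nat.Tactic.RingSolver using (solve-∀)
  open import Data.Fin as Fin using (Fin)
  open import Data.Fin.Properties using (_≟_)
  open import Data.List using (length; filter; tabulate)
  open import Relation.Nullary.Decidable using (_×-dec_; ¬?)
  open import Relation.Unary using (Pred; Decidable)
  open import Algebra.Properties.Semiring.Sum ℕP.+-*-semiring
    using (sum; sum-syntax; sum-cong-≗; ∑-distrib-+; ∑-comm; *-distribˡ-sum; *-distribʳ-sum; sum-replicate-zero)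

  𝟙 : ∀ {A : Set} → Dec A → ℕ
  𝟙 a = if does a then 1 else 0

  𝟙-yes : ∀ {A : Set} (a : Dec A) → A → 𝟙 a ≡ 1
  𝟙-yes (yes _) _ = refl
  𝟙-yes (no ¬x) x = contradiction x ¬x

  𝟙-⇔ : ∀ {A B : Set} (a : Dec A) (b : Dec B) → (A → B) → (B → A) → 𝟙 a ≡ 𝟙 b
  𝟙-⇔ (yes _) (yes _) _ _ = refl
  𝟙-⇔ (yes x) (no ¬y) f _ = contradiction (f x) ¬y
  𝟙-⇔ (no ¬x) (yes y) _ g = contradiction (g y) ¬x
  𝟙-⇔ (no _)  (no _)  _ _ = refl

  𝟙-× : ∀ {A B : Set} (a : Dec A) (b : Dec B) → 𝟙 (a ×-dec b) ≡ 𝟙 a * 𝟙 b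
  𝟙-× (yes _) (yes _) = refl
  𝟙-× (yes _) (no _)  = refl
  𝟙-× (no _)  _       = refl

  𝟙-×-≤ˡ : ∀ {A B : Set} (a : Dec A) (b : Dec B) → 𝟙 (a ×-dec b) ≤ 𝟙 a
  𝟙-×-≤ˡ (yes _) (yes _) = ℕP.≤-refl
  𝟙-×-≤ˡ (yes _) (no _)  = z≤n
  𝟙-×-≤ˡ (no _)  _       = z≤n

  𝟙-partition : ∀ {A B : Set} (a : Dec A) (b : Dec B) → (A → ¬ B) → 𝟙 a + 𝟙 b + 𝟙 (¬? a ×-dec ¬? b) ≡ 1
  𝟙-partition (yes x) (yes y) A⇒¬B = contradiction y (A⇒¬B x)
  𝟙-partition (yes _) (no _)  _    = refl
  𝟙-partition (no _)  (yes _) _    = refl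
  𝟙-partition (no _)  (no _)  _    = refl

  length-filter-tabulate : ∀ {A : Set} {P : Pred A _} (P? : Decidable P) {n} (f : Fin n → A) →
    length (filter P? (tabulate f)) ≡ ∑[ i < n ] 𝟙 (P? (f i))
  length-filter-tabulate P? {zero}  f = refl
  length-filter-tabulate P? {suc n} f with P? (f Fin.zero)
  ... | yes _ = cong suc (length-filter-tabulate P? (f ∘ Fin.suc))
  ... | no _  = length-filter-tabulate P? (f ∘ Fin.suc)

  ∑-mono-≤ : ∀ {n} {f g : Fin n → ℕ} → (∀ i → f i ≤ g i) → sum f ≤ sum g
  ∑-mono-≤ {zero}  f≤g = z≤n
  ∑-mono-≤ {suc n} f≤g = ℕP.+-mono-≤ (f≤g Fin.zero) (∑-mono-≤ (f≤g ∘ Fin.suc))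

  ∑-1 : ∀ n → ∑[ _ < n ] 1 ≡ n
  ∑-1 zero    = refl
  ∑-1 (suc n) = cong suc (∑-1 n)

  ∑-*-𝟙-≟ : ∀ {n} (f : Fin n → ℕ) (u : Fin n) → ∑[ z < n ] (f z * 𝟙 (z ≟ u)) ≡ f u
  ∑-*-𝟙-≟ {suc n} f Fin.zero = trans
    (cong₂ _+_ (ℕP.*-identityʳ (f Fin.zero)) (trans (sum-cong-≗ (ℕP.*-zeroʳ ∘ f ∘ Fin.suc)) (sum-replicate-zero n)))
    (ℕP.+-identityʳ (f Fin.zero))
  ∑-*-𝟙-≟ {suc n} f (Fin.suc u) = cong₂ _+_ (ℕP.*-zeroʳ (f Fin.zero)) (∑-*-𝟙-≟ (f ∘ Fin.suc) u)

  ∑-𝟙-≟ : ∀ {n} (u : Fin n) → ∑[ z < n ] 𝟙 (z ≟ u) ≡ 1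
  ∑-𝟙-≟ u = trans (sum-cong-≗ (λ z → sym (ℕP.*-identityˡ (𝟙 (z ≟ u))))) (∑-*-𝟙-≟ (λ _ → 1) u)

  module _ {v : ℕ} (Γ : Graph v) {k lam mu : ℕ} (srg : IsSRG Γ k lam mu) where
    open Graph Γ renaming (sym to adj-sym)
    open IsSRG srg

    ∑-adj : ∀ u → ∑[ z < v ] 𝟙 (adj? u z) ≡ k
    ∑-adj u = trans (sym (length-filter-tabulate (adj? u) (λ z → z))) (regular u)

    ∑-common : ∀ u w → ∑[ z < v ] 𝟙 (adj? u z ×-dec adj? w z) ≡ common u w
    ∑-common u w = sym (length-filter-tabulate (λ z → adj? u z ×-dec adj? w z) (λ z → z))

    mu≤k : mu ≤ k
    mu≤k with notComplete
    ... | u , w , u≢w , u≁w = subst₂ _≤_ (trans (∑-common u w) (nonadjCommon u w u≢w u≁w)) (∑-adj u)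
      (∑-mono-≤ (λ z → 𝟙-×-≤ˡ (adj? u z) (adj? w z)))

    lam<k : lam < k
    lam<k with notEdgeless
    ... | u , w , u∼w = subst₂ _≤_ count (∑-adj u) (∑-mono-≤ pointwise)
      where
      pointwise : ∀ z → 𝟙 (adj? u z ×-dec adj? w z) + 𝟙 (z ≟ w) ≤ 𝟙 (adj? u z)
      pointwise z with z ≟ w | adj? u z | adj? w z
      ... | yes refl | _      | yes w∼w = contradiction w∼w irrefl
      ... | yes refl | yes _  | no _    = ℕP.≤-refl
      ... | yes refl | no u≁w | no _    = contradiction u∼w u≁w
      ... | no _     | a      | b       = ℕP.≤-trans (ℕP.≤-reflexive (ℕP.+-identityʳ _)) (𝟙-×-≤ˡ a b)
      count : ∑[ z < v ] (𝟙 (adj? u z ×-dec adj? w z) + 𝟙 (z ≟ w)) ≡ suc lam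
      count = begin
        ∑[ z < v ] (𝟙 (adj? u z ×-dec adj? w z) + 𝟙 (z ≟ w))
          ≡⟨ ∑-distrib-+ (λ z → 𝟙 (adj? u z ×-dec adj? w z)) (λ z → 𝟙 (z ≟ w)) ⟩
        ∑[ z < v ] 𝟙 (adj? u z ×-dec adj? w z) + ∑[ z < v ] 𝟙 (z ≟ w)
          ≡⟨ cong₂ _+_ (trans (∑-common u w) (adjCommon u w u∼w)) (∑-𝟙-≟ w) ⟩
        lam + 1                                                   ≡⟨ ℕP.+-comm lam 1 ⟩
        suc lam                                                   ∎
        where open ≡-Reasoning

    module _ (u : Fin v) where

      far : Fin v → ℕ
      far z = 𝟙 (¬? (adj? u z) ×-dec ¬? (z ≟ u))

      partition : ∀ z → 𝟙 (adj? u z) + 𝟙 (z ≟ u) + far z ≡ 1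
      partition z = 𝟙-partition (adj? u z) (z ≟ u) (λ { u∼u refl → irrefl u∼u })

      vertex-count : v ≡ k + 1 + ∑[ z < v ] far z
      vertex-count = begin
        v                                                             ≡⟨ ∑-1 v ⟨
        ∑[ _ < v ] 1                                                  ≡⟨ sum-cong-≗ (sym ∘ partition) ⟩
        ∑[ z < v ] (𝟙 (adj? u z) + 𝟙 (z ≟ u) + far z)
          ≡⟨ ∑-distrib-+ (λ z → 𝟙 (adj? u z) + 𝟙 (z ≟ u)) far ⟩
        ∑[ z < v ] (𝟙 (adj? u z) + 𝟙 (z ≟ u)) + ∑[ z < v ] far z
          ≡⟨ cong (_+ ∑[ z < v ] far z) (∑-distrib-+ (λ z → 𝟙 (adj? u z)) (λ z → 𝟙 (z ≟ u))) ⟩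
        ∑[ z < v ] 𝟙 (adj? u z) + ∑[ z < v ] 𝟙 (z ≟ u) + ∑[ z < v ] far z
          ≡⟨ cong₂ (λ a b → a + b + ∑[ z < v ] far z) (∑-adj u) (∑-𝟙-≟ u) ⟩
        k + 1 + ∑[ z < v ] far z                                      ∎
        where open ≡-Reasoning

      neighbour-degree : ∀ w → Adj u w → k ≡ lam + 1 + ∑[ z < v ] (𝟙 (adj? w z) * far z)
      neighbour-degree w u∼w = begin
        k                                                               ≡⟨ ∑-adj w ⟨
        ∑[ z < v ] a z                                                  ≡⟨ sum-cong-≗ split ⟩
        ∑[ z < v ] (a z * 𝟙 (adj? u z) + a z * 𝟙 (z ≟ u) + a z * far z)
          ≡⟨ ∑-distrib-+ (λ z → a z * 𝟙 (adj? u z) + a z * 𝟙 (z ≟ u)) (λ z → a z * far z) ⟩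
        ∑[ z < v ] (a z * 𝟙 (adj? u z) + a z * 𝟙 (z ≟ u)) + ∑[ z < v ] (a z * far z)
          ≡⟨ cong (_+ ∑[ z < v ] (a z * far z)) (∑-distrib-+ (λ z → a z * 𝟙 (adj? u z)) (λ z → a z * 𝟙 (z ≟ u))) ⟩
        ∑[ z < v ] (a z * 𝟙 (adj? u z)) + ∑[ z < v ] (a z * 𝟙 (z ≟ u)) + ∑[ z < v ] (a z * far z)
          ≡⟨ cong₂ (λ x y → x + y + ∑[ z < v ] (a z * far z)) common-wu (∑-*-𝟙-≟ a u) ⟩
        lam + a u + ∑[ z < v ] (a z * far z)
          ≡⟨ cong (λ x → lam + x + ∑[ z < v ] (a z * far z)) (𝟙-yes (adj? w u) (adj-sym u∼w)) ⟩
        lam + 1 + ∑[ z < v ] (a z * far z)                              ∎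
        where
        open ≡-Reasoning
        a : Fin v → ℕ
        a z = 𝟙 (adj? w z)
        split : ∀ z → a z ≡ a z * 𝟙 (adj? u z) + a z * 𝟙 (z ≟ u) + a z * far z
        split z = begin
          a z                                                 ≡⟨ ℕP.*-identityʳ (a z) ⟨
          a z * 1                                             ≡⟨ cong (a z *_) (partition z) ⟨
          a z * (𝟙 (adj? u z) + 𝟙 (z ≟ u) + far z)
            ≡⟨ ℕP.*-distribˡ-+ (a z) (𝟙 (adj? u z) + 𝟙 (z ≟ u)) (far z) ⟩
          a z * (𝟙 (adj? u z) + 𝟙 (z ≟ u)) + a z * far z
            ≡⟨ cong (_+ a z * far z) (ℕP.*-distribˡ-+ (a z) (𝟙 (adj? u z)) (𝟙 (z ≟ u))) ⟩
          a z * 𝟙 (adj? u z) + a z * 𝟙 (z ≟ u) + a z * far z  ∎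
        common-wu : ∑[ z < v ] (a z * 𝟙 (adj? u z)) ≡ lam
        common-wu = trans (sum-cong-≗ (λ z → sym (𝟙-× (adj? w z) (adj? u z))))
                          (trans (∑-common w u) (adjCommon w u (adj-sym u∼w)))

      far-common : ∀ z → ∑[ w < v ] (𝟙 (adj? u w) * 𝟙 (adj? w z)) * far z ≡ mu * far z
      far-common z = by-cases (¬? (adj? u z) ×-dec ¬? (z ≟ u))
        where
        open ≡-Reasoning
        paths : ℕ
        paths = ∑[ w < v ] (𝟙 (adj? u w) * 𝟙 (adj? w z))
        by-cases : (far? : Dec (¬ Adj u z × z ≢ u)) → paths * 𝟙 far? ≡ mu * 𝟙 far?
        by-cases (no _)            = trans (ℕP.*-zeroʳ paths) (sym (ℕP.*-zeroʳ mu))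
        by-cases (yes (u≁z , z≢u)) = cong (_* 1) (begin
          paths
            ≡⟨ sum-cong-≗ (λ w → cong (𝟙 (adj? u w) *_) (𝟙-⇔ (adj? w z) (adj? z w) adj-sym adj-sym)) ⟩
          ∑[ w < v ] (𝟙 (adj? u w) * 𝟙 (adj? z w))  ≡⟨ sum-cong-≗ (λ w → sym (𝟙-× (adj? u w) (adj? z w))) ⟩
          ∑[ w < v ] 𝟙 (adj? u w ×-dec adj? z w)    ≡⟨ ∑-common u z ⟩
          common u z                                ≡⟨ nonadjCommon u z (z≢u ∘ sym) u≁z ⟩
          mu                                        ∎)

      -- Both sides count the paths u ∼ w ∼ z with z neither u nor a neighbour of u.
      double-count : k * k ≡ k * (lam + 1) + mu * ∑[ z < v ] far z
      double-count = begin
        k * k                                                       ≡⟨ cong (_* k) (∑-adj u) ⟨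
        ∑[ w < v ] a w * k                                          ≡⟨ *-distribʳ-sum k a ⟩
        ∑[ w < v ] (a w * k)                                        ≡⟨ sum-cong-≗ split ⟩
        ∑[ w < v ] (a w * (lam + 1) + a w * S w)                    ≡⟨ ∑-distrib-+ (λ w → a w * (lam + 1)) (λ w → a w * S w) ⟩
        ∑[ w < v ] (a w * (lam + 1)) + ∑[ w < v ] (a w * S w)
          ≡⟨ cong₂ _+_ (trans (sym (*-distribʳ-sum (lam + 1) a)) (cong (_* (lam + 1)) (∑-adj u)))
                       (sum-cong-≗ (λ w → *-distribˡ-sum (a w) (λ z → 𝟙 (adj? w z) * far z))) ⟩
        k * (lam + 1) + ∑[ w < v ] ∑[ z < v ] (a w * (𝟙 (adj? w z) * far z))
          ≡⟨ cong (_+_ (k * (lam + 1))) (∑-comm (λ w z → a w * (𝟙 (adj? w z) * far z))) ⟩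
        k * (lam + 1) + ∑[ z < v ] ∑[ w < v ] (a w * (𝟙 (adj? w z) * far z))
          ≡⟨ cong (_+_ (k * (lam + 1))) (sum-cong-≗ regroup) ⟩
        k * (lam + 1) + ∑[ z < v ] (mu * far z)                     ≡⟨ cong (_+_ (k * (lam + 1))) (*-distribˡ-sum mu far) ⟨
        k * (lam + 1) + mu * ∑[ z < v ] far z                       ∎
        where
        open ≡-Reasoning
        a S : Fin v → ℕ
        a w = 𝟙 (adj? u w)
        S w = ∑[ z < v ] (𝟙 (adj? w z) * far z)
        split : ∀ w → a w * k ≡ a w * (lam + 1) + a w * S w
        split w with adj? u w
        ... | no _    = refl
        ... | yes u∼w = trans (ℕP.*-identityˡ k) (trans (neighbour-degree w u∼w)
                          (sym (cong₂ _+_ (ℕP.*-identityˡ (lam + 1)) (ℕP.*-identityˡ (S w)))))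
        regroup : ∀ z → ∑[ w < v ] (a w * (𝟙 (adj? w z) * far z)) ≡ mu * far z
        regroup z = trans (sum-cong-≗ (λ w → sym (ℕP.*-assoc (a w) (𝟙 (adj? w z)) (far z))))
                          (trans (sym (*-distribʳ-sum (far z) (λ w → a w * 𝟙 (adj? w z)))) (far-common z))

    parameter-relation : mu * v + k * (lam + 1) ≡ k * k + mu * (k + 1)
    parameter-relation with notEdgeless
    ... | u , _ = begin
      mu * v + k * (lam + 1)                    ≡⟨ cong (λ n → mu * n + k * (lam + 1)) (vertex-count u) ⟩
      mu * (k + 1 + E) + k * (lam + 1)          ≡⟨ rearrange mu k lam E ⟩
      k * (lam + 1) + mu * E + mu * (k + 1)     ≡⟨ cong (_+ mu * (k + 1)) (double-count u) ⟨
      k * k + mu * (k + 1)                      ∎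
      where
      open ≡-Reasoning
      E : ℕ
      E = ∑[ z < v ] far u z
      rearrange : ∀ mu k lam E → mu * (k + 1 + E) + k * (lam + 1) ≡ k * (lam + 1) + mu * E + mu * (k + 1)
      rearrange = solve-∀

import Data.Nat.Properties as ℕP
open import Data.Nat using (suc)
open import Data.Integer using (0ℤ; _+_; _*_; _-_; -_; _≤_; _<_; +≤+; +<+; ∣_∣)
import Data.Integer.Properties as ℤP
import Data.Integer.DivMod as ℤD
open import Data.Integer.Tactic.RingSolver using (solve-∀)
import Data.Rational.Properties as ℚP
open import Data.Rational using (mkℚ; ↥_; ↧_; toℚᵘ; floor)
open import Data.Rational.Unnormalised as ℚᵘ using (mkℚᵘ; *≡*; *<*) renaming (_≃_ to _≃ᵘ_)
import Data.Rational.Unnormalised.Properties as ℚᵘP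

i<j⇒0<j-i : ∀ {i j} → i < j → 0ℤ < j - i
i<j⇒0<j-i {i} {j} i<j = subst (_< j - i) (ℤP.+-inverseʳ i) (ℤP.+-monoˡ-< (- i) i<j)

0<j-i⇒i<j : ∀ {i j} → 0ℤ < j - i → i < j
0<j-i⇒i<j {i} {j} 0<j-i = subst₂ _<_ (ℤP.+-identityˡ i) (cancel i j) (ℤP.+-monoˡ-< i 0<j-i)
  where cancel : ∀ i j → j - i + i ≡ j
        cancel = solve-∀

0<⇒0≤-1 : ∀ {i} → 0ℤ < i → 0ℤ ≤ i - + 1
0<⇒0≤-1 0<i = ℤP.i≤j⇒0≤j-i (ℤP.i<j⇒suc[i]≤j 0<i)

0≤*0≤ : ∀ {i j} → 0ℤ ≤ i → 0ℤ ≤ j → 0ℤ ≤ i * j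
0≤*0≤ {+ m} {+ n} _ _ = subst (0ℤ ≤_) (ℤP.pos-* m n) (+≤+ ℕ.z≤n)

0<*0< : ∀ {i j} → 0ℤ < i → 0ℤ < j → 0ℤ < i * j
0<*0< (+<+ (ℕ.s≤s _)) (+<+ (ℕ.s≤s _)) = +<+ (ℕ.s≤s ℕ.z≤n)

0<-cancel-*ˡ : ∀ {i j} → 0ℤ ≤ i → 0ℤ < i * j → 0ℤ < j
0<-cancel-*ˡ {i} {j} 0≤i 0<ij =
  ℤP.*-cancelˡ-<-nonNeg i {{ℤ.nonNegative 0≤i}} (subst (_< i * j) (sym (ℤP.*-zeroʳ i)) 0<ij)

0≤+0<≢0 : ∀ {i j} → 0ℤ ≤ i → 0ℤ < j → i + j ≢ 0ℤ
0≤+0<≢0 0≤i 0<j i+j≡0 = ℤP.<-irrefl (sym i+j≡0) (ℤP.+-mono-≤-< 0≤i 0<j)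

i≤+∣i∣ : ∀ i → i ≤ + ∣ i ∣
i≤+∣i∣ (+ _)      = ℤP.≤-refl
i≤+∣i∣ ℤ.-[1+ _ ] = ℤ.-≤+

no-integer-strictly-between : ∀ {q v} → q < v → v < q + + 1 → ⊥
no-integer-strictly-between {q} q<v v<q+1 =
  ℤP.<⇒≱ v<q+1 (subst (_≤ _) (ℤP.+-comm (+ 1) q) (ℤP.i<j⇒suc[i]≤j q<v))

∃-centred-odd-multiple : ∀ z w → 0ℤ < w →
  ∃[ x ] (let T = w * (+ 2 * x + + 1) - + 2 * z in 0ℤ ≤ w - T × 0ℤ ≤ w + T)
∃-centred-odd-multiple z (+ suc n) (+<+ _) =
  z ℤD./ℕ suc n , bounds {z ℤD./ℕ suc n} (ℤD.[n/ℕd]*d≤n z (suc n)) (ℤD.n<s[n/ℕd]*d z (suc n))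
  where
  w : ℤ
  w = + suc n
  bounds : ∀ {x} → x * w ≤ z → z < (+ 1 + x) * w →
    let T = w * (+ 2 * x + + 1) - + 2 * z in 0ℤ ≤ w - T × 0ℤ ≤ w + T
  bounds {x} xw≤z z<[1+x]w =
    subst (0ℤ ≤_) (lower z w x) (0≤*0≤ {+ 2} (+≤+ ℕ.z≤n) (ℤP.i≤j⇒0≤j-i xw≤z)) ,
    subst (0ℤ ≤_) (upper z w x) (0≤*0≤ {+ 2} (+≤+ ℕ.z≤n) (ℤP.<⇒≤ (i<j⇒0<j-i z<[1+x]w)))
    where
    lower : ∀ z w x → + 2 * (z - x * w) ≡ w - (w * (+ 2 * x + + 1) - + 2 * z)
    lower = solve-∀
    upper : ∀ z w x → + 2 * ((+ 1 + x) * w - z) ≡ w + (w * (+ 2 * x + + 1) - + 2 * z)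
    upper = solve-∀

-- Restricted eigenvalues

vieta : ∀ {b c ρ σ} → ρ * ρ - b * ρ - c ≡ 0ℤ → σ * σ - b * σ - c ≡ 0ℤ → σ < ρ → b ≡ ρ + σ × c ≡ - (ρ * σ)
vieta {b} {c} {ρ} {σ} ρ-root σ-root σ<ρ = b≡ρ+σ , c≡-ρσ
  where
  open ≡-Reasoning
  difference : (ρ - σ) * (ρ + σ - b) ≡ 0ℤ
  difference = begin
    (ρ - σ) * (ρ + σ - b)                       ≡⟨ factor b c ρ σ ⟩
    (ρ * ρ - b * ρ - c) - (σ * σ - b * σ - c)   ≡⟨ cong₂ _-_ ρ-root σ-root ⟩
    0ℤ                                          ∎
    where factor : ∀ b c ρ σ → (ρ - σ) * (ρ + σ - b) ≡ (ρ * ρ - b * ρ - c) - (σ * σ - b * σ - c)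
          factor = solve-∀
  b≡ρ+σ : b ≡ ρ + σ
  b≡ρ+σ with ℤP.i*j≡0⇒i≡0∨j≡0 (ρ - σ) difference
  ... | inj₁ ρ-σ≡0   = contradiction (ℤP.i-j≡0⇒i≡j ρ σ ρ-σ≡0) (≢-sym (ℤP.<⇒≢ σ<ρ))
  ... | inj₂ ρ+σ-b≡0 = sym (ℤP.i-j≡0⇒i≡j (ρ + σ) b ρ+σ-b≡0)
  c≡-ρσ : c ≡ - (ρ * σ)
  c≡-ρσ = begin
    c                                      ≡⟨ isolate b c σ ⟩
    σ * σ - b * σ - (σ * σ - b * σ - c)    ≡⟨ cong₂ (λ b′ r → σ * σ - b′ * σ - r) b≡ρ+σ σ-root ⟩
    σ * σ - (ρ + σ) * σ - 0ℤ               ≡⟨ simplify ρ σ ⟩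
    - (ρ * σ)                              ∎
    where isolate : ∀ b c σ → c ≡ σ * σ - b * σ - (σ * σ - b * σ - c)
          isolate = solve-∀
          simplify : ∀ ρ σ → σ * σ - (ρ + σ) * σ - 0ℤ ≡ - (ρ * σ)
          simplify = solve-∀

restricted-eigenvalues : ∀ {k lam mu ρ σ} → IsRestrictedRoot k lam mu ρ → IsRestrictedRoot k lam mu σ → σ < ρ →
  + k ≡ + mu - ρ * σ × + lam ≡ + mu + ρ + σ
restricted-eigenvalues {k} {lam} {mu} {ρ} {σ} ρ-root σ-root σ<ρ
  with vieta {+ lam - + mu} {+ k - + mu} ρ-root σ-root σ<ρ
... | b≡ρ+σ , c≡-ρσ =
  trans (shift (+ k) (+ mu)) (cong (_+_ (+ mu)) c≡-ρσ) ,
  trans (shift (+ lam) (+ mu)) (trans (cong (_+_ (+ mu)) b≡ρ+σ) (sym (ℤP.+-assoc (+ mu) ρ σ)))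
  where shift : ∀ a m → a ≡ m + (a - m)
        shift = solve-∀

eigenvalue-signs : ∀ {μ ρ σ} → σ < ρ → μ ≤ μ - ρ * σ → μ + ρ + σ < μ - ρ * σ → σ < 0ℤ × 0ℤ ≤ ρ
eigenvalue-signs {μ} {ρ} {σ} σ<ρ μ≤k λ<k = σ<0 , 0≤ρ
  where
  σ<0 : σ < 0ℤ
  σ<0 with σ ℤ.<? 0ℤ
  ... | yes σ<0 = σ<0
  ... | no σ≮0  = contradiction (ℤP.+-inverseʳ (ρ * σ + ρ + σ))
                    (0≤+0<≢0 0≤ρσ+ρ+σ (subst (0ℤ <_) (identity μ ρ σ) (i<j⇒0<j-i λ<k)))
    where
    0≤σ : 0ℤ ≤ σ
    0≤σ = ℤP.≮⇒≥ σ≮0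
    0≤ρσ+ρ+σ : 0ℤ ≤ ρ * σ + ρ + σ
    0≤ρσ+ρ+σ = ℤP.+-mono-≤ (ℤP.+-mono-≤ (0≤*0≤ 0≤ρ′ 0≤σ) 0≤ρ′) 0≤σ
      where 0≤ρ′ : 0ℤ ≤ ρ
            0≤ρ′ = ℤP.≤-trans 0≤σ (ℤP.<⇒≤ σ<ρ)
    identity : ∀ μ ρ σ → (μ - ρ * σ) - (μ + ρ + σ) ≡ - (ρ * σ + ρ + σ)
    identity = solve-∀
  0≤ρ : 0ℤ ≤ ρ
  0≤ρ with ρ ℤ.<? 0ℤ
  ... | no ρ≮0  = ℤP.≮⇒≥ ρ≮0
  ... | yes ρ<0 = contradiction (ℤP.+-inverseˡ (ρ * σ))
                    (0≤+0<≢0 (subst (0ℤ ≤_) (identity μ ρ σ) (ℤP.i≤j⇒0≤j-i μ≤k)) 0<ρσ)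
    where
    0<ρσ : 0ℤ < ρ * σ
    0<ρσ = subst (0ℤ <_) (neg*neg ρ σ) (0<*0< (ℤP.neg-mono-< ρ<0) (ℤP.neg-mono-< (ℤP.<-trans σ<ρ ρ<0)))
      where neg*neg : ∀ ρ σ → (- ρ) * (- σ) ≡ ρ * σ
            neg*neg = solve-∀
    identity : ∀ μ ρ σ → (μ - ρ * σ) - μ ≡ - (ρ * σ)
    identity = solve-∀

counting-identity : ∀ {μ ρ σ v} → let k = μ - ρ * σ ; lam = μ + ρ + σ in
  μ * v + k * (lam + + 1) ≡ k * k + μ * (k + + 1) → μ * v ≡ (k - σ) * (k - ρ)
counting-identity {μ} {ρ} {σ} {v} relation = begin
  μ * v                                        ≡⟨ isolate (μ * v) (k * (lam + + 1)) ⟩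
  μ * v + k * (lam + + 1) - k * (lam + + 1)    ≡⟨ cong (_- k * (lam + + 1)) relation ⟩
  k * k + μ * (k + + 1) - k * (lam + + 1)      ≡⟨ factor μ ρ σ ⟩
  (k - σ) * (k - ρ)                            ∎
  where
  open ≡-Reasoning
  k lam : ℤ
  k = μ - ρ * σ
  lam = μ + ρ + σ
  isolate : ∀ a b → a ≡ a + b - b
  isolate = solve-∀
  factor : ∀ μ ρ σ → let k = μ - ρ * σ ; lam = μ + ρ + σ in
    k * k + μ * (k + + 1) - k * (lam + + 1) ≡ (k - σ) * (k - ρ)
  factor = solve-∀

-- Floor and fractional part of a ratio

toℚᵘ-/1 : ∀ i → toℚᵘ (i ℚ./ 1) ≃ᵘ mkℚᵘ i 0
toℚᵘ-/1 i = ℚP.toℚᵘ-fromℚᵘ (mkℚᵘ i 0)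

/1-mono-< : ∀ {i j} → i < j → i ℚ./ 1 ℚ.< j ℚ./ 1
/1-mono-< {i} {j} i<j = ℚP.toℚᵘ-cancel-< (begin-strict
  toℚᵘ (i ℚ./ 1)   ≃⟨ toℚᵘ-/1 i ⟩
  mkℚᵘ i 0         <⟨ *<* (subst₂ _<_ (sym (ℤP.*-identityʳ i)) (sym (ℤP.*-identityʳ j)) i<j) ⟩
  mkℚᵘ j 0         ≃⟨ toℚᵘ-/1 j ⟨
  toℚᵘ (j ℚ./ 1)   ∎)
  where open ℚᵘP.≤-Reasoning

/1-cancel-< : ∀ {i j} → i ℚ./ 1 ℚ.< j ℚ./ 1 → i < j
/1-cancel-< {i} {j} i/1<j/1 with ℚᵘP.<-respʳ-≃ (toℚᵘ-/1 j) (ℚᵘP.<-respˡ-≃ (toℚᵘ-/1 i) (ℚP.toℚᵘ-mono-< i/1<j/1))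
... | *<* i*1<j*1 = subst₂ _<_ (ℤP.*-identityʳ i) (ℤP.*-identityʳ j) i*1<j*1

/1≢0 : ∀ {i} → i ≢ 0ℤ → i ℚ./ 1 ≢ 0ℚ
/1≢0 {i} i≢0 i/1≡0 with ℚᵘP.≃-trans (ℚᵘP.≃-sym (toℚᵘ-/1 i)) (ℚP.toℚᵘ-cong i/1≡0)
... | *≡* i*1≡0 = i≢0 (trans (sym (ℤP.*-identityʳ i)) i*1≡0)

÷′-*-cancel : ∀ p q → q ≢ 0ℚ → (p ÷′ q) ℚ.* q ≡ p
÷′-*-cancel p q q≢0 with q ℚP.≟ 0ℚ
... | yes q≡0 = contradiction q≡0 q≢0
... | no q≢0′ = let instance _ = ℚ.≢-nonZero q≢0′ in begin
  p ℚ.* ℚ.1/ q ℚ.* q    ≡⟨ ℚP.*-assoc p (ℚ.1/ q) q ⟩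
  p ℚ.* (ℚ.1/ q ℚ.* q)  ≡⟨ cong (p ℚ.*_) (ℚP.*-inverseˡ q) ⟩
  p ℚ.* ℚ.1ℚ            ≡⟨ ℚP.*-identityʳ p ⟩
  p                     ∎
  where open ≡-Reasoning

↥÷′↧ : ∀ N K → K ≢ 0ℤ → let h = (N ℚ./ 1) ÷′ (K ℚ./ 1) in ↥ h * K ≡ N * ↧ h
↥÷′↧ N K K≢0 = cross h h*K≃N
  where
  h : ℚ
  h = (N ℚ./ 1) ÷′ (K ℚ./ 1)
  h*K≃N : toℚᵘ h ℚᵘ.* mkℚᵘ K 0 ≃ᵘ mkℚᵘ N 0
  h*K≃N = begin
    toℚᵘ h ℚᵘ.* mkℚᵘ K 0            ≈⟨ ℚᵘP.*-congˡ {toℚᵘ h} (toℚᵘ-/1 K) ⟨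
    toℚᵘ h ℚᵘ.* toℚᵘ (K ℚ./ 1)      ≈⟨ ℚP.toℚᵘ-homo-* h (K ℚ./ 1) ⟨
    toℚᵘ (h ℚ.* (K ℚ./ 1))          ≡⟨ cong toℚᵘ (÷′-*-cancel (N ℚ./ 1) (K ℚ./ 1) (/1≢0 K≢0)) ⟩
    toℚᵘ (N ℚ./ 1)                  ≈⟨ toℚᵘ-/1 N ⟩
    mkℚᵘ N 0                        ∎
    where open ℚᵘP.≃-Reasoning
  cross : ∀ h → toℚᵘ h ℚᵘ.* mkℚᵘ K 0 ≃ᵘ mkℚᵘ N 0 → ↥ h * K ≡ N * ↧ h
  cross (mkℚ P d _) (*≡* PK≡ND) = begin
    P * K                       ≡⟨ ℤP.*-identityʳ (P * K) ⟨
    P * K * + 1                 ≡⟨ PK≡ND ⟩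
    N * + suc (d ℕ.* 1)         ≡⟨ cong (λ n → N * + suc n) (ℕP.*-identityʳ d) ⟩
    N * + suc d                 ∎
    where open ≡-Reasoning

cross-rescale : ∀ {P D K N M H} → K ≢ 0ℤ → P * K ≡ N * D → M * N ≡ K * H → P * M ≡ H * D
cross-rescale {P} {D} {K} {N} {M} {H} K≢0 PK≡ND MN≡KH = ℤP.*-cancelˡ-≡ K (P * M) (H * D) {{ℤ.≢-nonZero K≢0}} (begin
  K * (P * M)     ≡⟨ swap K P M ⟩
  M * (P * K)     ≡⟨ cong (M *_) PK≡ND ⟩
  M * (N * D)     ≡⟨ ℤP.*-assoc M N D ⟨
  M * N * D       ≡⟨ cong (_* D) MN≡KH ⟩
  K * H * D       ≡⟨ ℤP.*-assoc K H D ⟩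
  K * (H * D)     ∎)
  where open ≡-Reasoning
        swap : ∀ K P M → K * (P * M) ≡ M * (P * K)
        swap = solve-∀

module FloorOfRatio (h : ℚ) (M H : ℤ) (h≡H/M : ↥ h * M ≡ H * ↧ h) where

  private
    toℚᵘ-frac : toℚᵘ (frac h) ≃ᵘ toℚᵘ h ℚᵘ.- mkℚᵘ (floor h) 0
    toℚᵘ-frac = ℚᵘP.≃-trans (ℚP.toℚᵘ-homo-+ h (ℚ.- (floor h ℚ./ 1)))
      (ℚᵘP.+-congʳ (toℚᵘ h) (ℚᵘP.≃-trans (ℚP.toℚᵘ-homo‿- (floor h ℚ./ 1)) (ℚᵘP.-‿cong (toℚᵘ-/1 (floor h)))))

    compute : ∀ h → ↥ h * M ≡ H * ↧ h →
      (toℚᵘ h ℚᵘ.- mkℚᵘ (floor h) 0) ℚᵘ.* mkℚᵘ M 0 ≃ᵘ mkℚᵘ (H - M * floor h) 0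
    compute h@(mkℚ P d _) PM≡HD = *≡* (begin
      (P * + 1 + - q * D) * M * + 1       ≡⟨ expand P q D M ⟩
      P * M - M * q * D                   ≡⟨ cong (_- M * q * D) PM≡HD ⟩
      H * D - M * q * D                   ≡⟨ factor H (M * q) D ⟩
      (H - M * q) * D                     ≡⟨ cong (λ n → (H - M * q) * + suc n) (trans (ℕP.*-identityʳ _) (ℕP.*-identityʳ d)) ⟨
      (H - M * q) * + suc (d ℕ.* 1 ℕ.* 1) ∎)
      where
      open ≡-Reasoning
      q D : ℤ
      q = floor h
      D = + suc d
      expand : ∀ P q D M → (P * + 1 + - q * D) * M * + 1 ≡ P * M - M * q * D
      expand = solve-∀
      factor : ∀ H a D → H * D - a * D ≡ (H - a) * D
      factor = solve-∀

  frac*M : frac h ℚ.* (M ℚ./ 1) ≡ (H - M * floor h) ℚ./ 1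
  frac*M = ℚP.toℚᵘ-injective (begin
    toℚᵘ (frac h ℚ.* (M ℚ./ 1))                       ≈⟨ ℚP.toℚᵘ-homo-* (frac h) (M ℚ./ 1) ⟩
    toℚᵘ (frac h) ℚᵘ.* toℚᵘ (M ℚ./ 1)                 ≈⟨ ℚᵘP.*-cong toℚᵘ-frac (toℚᵘ-/1 M) ⟩
    (toℚᵘ h ℚᵘ.- mkℚᵘ (floor h) 0) ℚᵘ.* mkℚᵘ M 0      ≈⟨ compute h h≡H/M ⟩
    mkℚᵘ (H - M * floor h) 0                          ≈⟨ toℚᵘ-/1 (H - M * floor h) ⟨
    toℚᵘ ((H - M * floor h) ℚ./ 1)                    ∎)
    where open ℚᵘP.≃-Reasoning

  module _ (0<M : 0ℤ < M) where

    private instance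
      M-pos : ℤ.Positive M
      M-pos = ℤ.positive 0<M
      M/1-pos : ℚ.Positive (M ℚ./ 1)
      M/1-pos = ℚ.positive (/1-mono-< 0<M)

    H<M[⌊h⌋+1] : H < M * (floor h + + 1)
    H<M[⌊h⌋+1] = bound h h≡H/M
      where
      bound : ∀ h → ↥ h * M ≡ H * ↧ h → H < M * (floor h + + 1)
      bound h@(mkℚ P d _) PM≡HD = ℤP.*-cancelʳ-<-nonNeg D (begin-strict
        H * D                 ≡⟨ PM≡HD ⟨
        P * M                 <⟨ ℤP.*-monoʳ-<-pos M P<[1+q]D ⟩
        (+ 1 + q) * D * M     ≡⟨ reorder q D M ⟩
        M * (q + + 1) * D     ∎)
        where
        open ℤP.≤-Reasoning
        D q : ℤ
        D = + suc d
        q = floor h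
        P<[1+q]D : P < (+ 1 + q) * D
        P<[1+q]D = subst (λ t → P < (+ 1 + t) * D) (sym (ℤD.div-pos-is-/ℕ P (suc d))) (ℤD.n<s[n/ℕd]*d P (suc d))
        reorder : ∀ q D M → (+ 1 + q) * D * M ≡ M * (q + + 1) * D
        reorder = solve-∀

    0<frac⇒M⌊h⌋<H : 0ℚ ℚ.< frac h → M * floor h < H
    0<frac⇒M⌊h⌋<H 0<frac = 0<j-i⇒i<j (/1-cancel-<
      (subst₂ ℚ._<_ (ℚP.*-zeroˡ (M ℚ./ 1)) frac*M (ℚP.*-monoˡ-<-pos (M ℚ./ 1) 0<frac)))

    frac<⇒H-M⌊h⌋< : ∀ B → frac h ℚ.< (B ℚ./ 1) ÷′ (M ℚ./ 1) → H - M * floor h < B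
    frac<⇒H-M⌊h⌋< B frac<B/M = /1-cancel-<
      (subst₂ ℚ._<_ frac*M (÷′-*-cancel (B ℚ./ 1) (M ℚ./ 1) (/1≢0 (≢-sym (ℤP.<⇒≢ 0<M))))
        (ℚP.*-monoˡ-<-pos (M ℚ./ 1) frac<B/M))

-- The polynomial R

-- R over ℤ: R v k lam mu x y d is definitionally Rℤ (+ v) (+ k) (+ lam) (+ mu) x (+ y) (+ d).
Rℤ : (v k lam μ x y d : ℤ) → ℤ
Rℤ v k lam μ x y d =
  x * (x + + 1) * (v - y) - + 2 * x * y * k + (+ 2 * x + lam - μ + + 1) * y * d + y * (y - + 1) * μ - y * d * d

-- In the next three identities Rℤ is written out, since the ring solver does not unfold definitions.
R-at-d-σ-1 : ∀ μ ρ σ v d q →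
  let k = μ - ρ * σ ; lam = μ + ρ + σ ; K = k - σ ; H = (d - σ) * (k - ρ) ; x = d - σ - + 1 ; y = q
  in μ * (x * (x + + 1) * (v - y) - + 2 * x * y * k + (+ 2 * x + lam - μ + + 1) * y * d + y * (y - + 1) * μ - y * d * d)
     + (K - (d - σ) * (ρ - σ) - (H - μ * q)) * (H - μ * q)
     ≡ (d - σ - + 1) * (d - σ) * (μ * v - K * (k - ρ))
R-at-d-σ-1 = solve-∀

R-completed-square : ∀ μ ρ σ v d y x →
  let k = μ - ρ * σ ; lam = μ + ρ + σ ; K = k - σ ; H = (d - σ) * (k - ρ)
      w = v - y ; T = w * (+ 2 * x + + 1) - + 2 * (y * (k - d)) ; P = μ * y - H
  in + 4 * μ * w * (x * (x + + 1) * (v - y) - + 2 * x * y * k + (+ 2 * x + lam - μ + + 1) * y * d + y * (y - + 1) * μ - y * d * d)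
     + μ * ((w - T) * (w + T)) + + 4 * y * (P * (P + (ρ - σ) * (k - d)))
     ≡ + 4 * y * ((k - d) + (lam - μ + + 1) * d + (y - + 1) * μ - d * d) * (μ * v - K * (k - ρ))
R-completed-square = solve-∀

R-at-v : ∀ k lam μ v d x →
  let y = v ; C = (lam - μ + + 1) * d + (v - + 1) * μ - d * d
  in x * (x + + 1) * (v - y) - + 2 * x * y * k + (+ 2 * x + lam - μ + + 1) * y * d + y * (y - + 1) * μ - y * d * d
     + v * (+ 2 * x * (k - d) - C) ≡ 0ℤ
R-at-v = solve-∀

-- k and λ are expressed through the restricted eigenvalues, and H = μ·h_d.
module TypeIIBound (μ ρ σ v d : ℤ) where

  k lam K H : ℤ
  k   = μ - ρ * σ
  lam = μ + ρ + σ
  K   = k - σ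
  H   = (d - σ) * (k - ρ)

  InSℤ : ℤ → Set
  InSℤ y = d < y × y ≤ v × (∀ x → 0ℤ ≤ Rℤ v k lam μ x y d)

  μ[v[d-σ]]≡K*H : μ * v ≡ K * (k - ρ) → μ * (v * (d - σ)) ≡ K * H
  μ[v[d-σ]]≡K*H counting = begin
    μ * (v * (d - σ))        ≡⟨ ℤP.*-assoc μ v (d - σ) ⟨
    μ * v * (d - σ)          ≡⟨ cong (_* (d - σ)) counting ⟩
    K * (k - ρ) * (d - σ)    ≡⟨ regroup K (k - ρ) (d - σ) ⟩
    K * H                    ∎
    where open ≡-Reasoning
          regroup : ∀ a b c → a * b * c ≡ a * (c * b)
          regroup = solve-∀

  -- Each y is excluded by an identity (nonnegative) + (positive) ≡ c·(μv - K(k - ρ)), whose right side vanishes.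
  module Bound (0<μ : 0ℤ < μ) (σ<0 : σ < 0ℤ) (0≤ρ : 0ℤ ≤ ρ) (0≤d : 0ℤ ≤ d) (d≤k : d ≤ k)
               (counting : μ * v ≡ K * (k - ρ))
               {q : ℤ} (μq<H : μ * q < H) (H<μ[q+1] : H < μ * (q + + 1))
               (H-μq<B : H - μ * q < K - (d - σ) * (ρ - σ)) where

    private
      0≤μ : 0ℤ ≤ μ
      0≤μ = ℤP.<⇒≤ 0<μ

      0≤-σ : 0ℤ ≤ - σ
      0≤-σ = ℤP.<⇒≤ (ℤP.neg-mono-< σ<0)

      0≤-σ-1 : 0ℤ ≤ - σ - + 1
      0≤-σ-1 = 0<⇒0≤-1 (ℤP.neg-mono-< σ<0)

      0≤k-d : 0ℤ ≤ k - d
      0≤k-d = ℤP.i≤j⇒0≤j-i d≤k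

      c*E≡0 : ∀ c → c * (μ * v - K * (k - ρ)) ≡ 0ℤ
      c*E≡0 c = trans (cong (c *_) (ℤP.i≡j⇒i-j≡0 counting)) (ℤP.*-zeroʳ c)

    μ≤k-ρ : 0ℤ ≤ k - ρ - μ
    μ≤k-ρ = subst (0ℤ ≤_) (identity μ ρ σ) (0≤*0≤ 0≤ρ 0≤-σ-1)
      where identity : ∀ μ ρ σ → ρ * (- σ - + 1) ≡ μ - ρ * σ - ρ - μ
            identity = solve-∀

    μ≤H : 0ℤ ≤ H - μ
    μ≤H = subst (0ℤ ≤_) (identity d σ μ k ρ)
      (ℤP.+-mono-≤ (0≤*0≤ (ℤP.+-mono-≤ 0≤d 0≤-σ-1) (ℤP.+-mono-≤ μ≤k-ρ 0≤μ)) μ≤k-ρ)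
      where identity : ∀ d σ μ k ρ → (d + (- σ - + 1)) * ((k - ρ - μ) + μ) + (k - ρ - μ) ≡ (d - σ) * (k - ρ) - μ
            identity = solve-∀

    0<q : 0ℤ < q
    0<q = 0<-cancel-*ˡ 0≤μ (subst (0ℤ <_) (identity μ q H) (ℤP.+-mono-<-≤ (i<j⇒0<j-i H<μ[q+1]) μ≤H))
      where identity : ∀ μ q H → (μ * (q + + 1) - H) + (H - μ) ≡ μ * q
            identity = solve-∀

    d<k : d < k
    d<k = ℤP.≤∧≢⇒< d≤k d≢k
      where
      d≢k : d ≢ k
      d≢k d≡k = no-integer-strictly-between
        (ℤP.*-cancelˡ-<-nonNeg μ {{ℤ.nonNegative 0≤μ}} (subst (μ * q <_) H≡μv μq<H))
        (ℤP.*-cancelˡ-<-nonNeg μ {{ℤ.nonNegative 0≤μ}} (subst (_< μ * (q + + 1)) H≡μv H<μ[q+1]))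
        where H≡μv : H ≡ μ * v
              H≡μv = trans (cong (λ t → (t - σ) * (k - ρ)) d≡k) (sym counting)

    -- At x = d - σ - 1 the two factors are the two gaps of the hypothesis on frac(h_d).
    q∉S : ¬ InSℤ q
    q∉S (_ , _ , R≥0) = 0≤+0<≢0
      (0≤*0≤ 0≤μ (R≥0 (d - σ - + 1)))
      (0<*0< (i<j⇒0<j-i H-μq<B) (i<j⇒0<j-i μq<H))
      (trans (R-at-d-σ-1 μ ρ σ v d q) (c*E≡0 ((d - σ - + 1) * (d - σ))))

    y∉S : ∀ {y} → q < y → y < v → ¬ InSℤ y
    y∉S {y} q<y y<v (d<y , _ , R≥0) with ∃-centred-odd-multiple (y * (k - d)) (v - y) (i<j⇒0<j-i y<v)
    ... | x , 0≤w-T , 0≤w+T = 0≤+0<≢0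
      (ℤP.+-mono-≤ (0≤*0≤ (0≤*0≤ {+ 4 * μ} (0≤*0≤ {+ 4} (+≤+ ℕ.z≤n) 0≤μ) (ℤP.<⇒≤ (i<j⇒0<j-i y<v))) (R≥0 x))
                   (0≤*0≤ 0≤μ (0≤*0≤ 0≤w-T 0≤w+T)))
      (0<*0< (0<*0< {+ 4} (+<+ (ℕ.s≤s ℕ.z≤n)) 0<y)
             (0<*0< 0<P (ℤP.+-mono-<-≤ 0<P (0≤*0≤ (ℤP.+-mono-≤ 0≤ρ 0≤-σ) 0≤k-d))))
      (trans (R-completed-square μ ρ σ v d y x) (c*E≡0 (+ 4 * y * ((k - d) + (lam - μ + + 1) * d + (y - + 1) * μ - d * d))))
      where
      0<y : 0ℤ < y
      0<y = ℤP.≤-<-trans 0≤d d<y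
      0<P : 0ℤ < μ * y - H
      0<P = subst (0ℤ <_) (identity μ y q H)
        (ℤP.+-mono-≤-< (0≤*0≤ 0≤μ (0<⇒0≤-1 (i<j⇒0<j-i q<y))) (i<j⇒0<j-i H<μ[q+1]))
        where identity : ∀ μ y q H → μ * (y - q - + 1) + (μ * (q + + 1) - H) ≡ μ * y - H
              identity = solve-∀

    v∉S : ¬ InSℤ v
    v∉S (d<v , _ , R≥0) = 0≤+0<≢0 (R≥0 x)
      (0<*0< (ℤP.≤-<-trans 0≤d d<v) (subst (0ℤ <_) (identity x k d C) 0<2x[k-d-1]+x+[x-C]))
      (R-at-v k lam μ v d x)
      where
      C x : ℤ
      C = (lam - μ + + 1) * d + (v - + 1) * μ - d * d
      x = + ∣ C ∣ + + 1
      0≤x : 0ℤ ≤ x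
      0≤x = +≤+ ℕ.z≤n
      0<2x[k-d-1]+x+[x-C] : 0ℤ < + 2 * x * (k - d - + 1) + x + (x - C)
      0<2x[k-d-1]+x+[x-C] = ℤP.+-mono-≤-<
        (ℤP.+-mono-≤ (0≤*0≤ (0≤*0≤ {+ 2} (+≤+ ℕ.z≤n) 0≤x) (0<⇒0≤-1 (i<j⇒0<j-i d<k))) 0≤x)
        (i<j⇒0<j-i (ℤP.≤-<-trans (i≤+∣i∣ C) (+<+ (ℕP.m<m+n ∣ C ∣ ℕ.z<s))))
      identity : ∀ x k d C → + 2 * x * (k - d - + 1) + x + (x - C) ≡ + 2 * x * (k - d) - C
      identity = solve-∀

    ∈S⇒<q : ∀ {y} → InSℤ y → y < q
    ∈S⇒<q {y} y∈S@(_ , y≤v , _) with ℤP.<-cmp y q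
    ... | tri< y<q _ _  = y<q
    ... | tri≈ _ refl _ = contradiction y∈S q∉S
    ... | tri> _ _ q<y with ℤP.<-cmp y v
    ...   | tri< y<v _ _  = contradiction y∈S (y∉S q<y y<v)
    ...   | tri≈ _ refl _ = contradiction y∈S v∉S
    ...   | tri> _ _ v<y  = contradiction y≤v (ℤP.<⇒≱ v<y)

ℕ→ℤ-relation : ∀ a b c e → + (a ℕ.* b ℕ.+ c ℕ.* (e ℕ.+ 1)) ≡ + a * + b + + c * (+ e + + 1)
ℕ→ℤ-relation a b c e = trans (ℤP.pos-+ (a ℕ.* b) (c ℕ.* (e ℕ.+ 1)))
  (cong₂ _+_ (ℤP.pos-* a b) (trans (ℤP.pos-* c (e ℕ.+ 1)) (cong (+ c *_) (ℤP.pos-+ e 1))))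

type-II-counting : ∀ {v k lam mu ρ σ} {Γ : Graph v} → IsSRG Γ k lam mu →
  + k ≡ + mu - ρ * σ → + lam ≡ + mu + ρ + σ → + mu * + v ≡ (+ mu - ρ * σ - σ) * (+ mu - ρ * σ - ρ)
type-II-counting {v} {k} {lam} {mu} {ρ} {σ} srg k≡ lam≡ = counting-identity {+ mu} {ρ} {σ}
  (subst₂ (λ κ l → + mu * + v + κ * (l + + 1) ≡ κ * κ + + mu * (κ + + 1)) k≡ lam≡ (begin
    + mu * + v + + k * (+ lam + + 1)       ≡⟨ ℕ→ℤ-relation mu v k lam ⟨
    + (mu ℕ.* v ℕ.+ k ℕ.* (lam ℕ.+ 1))     ≡⟨ cong +_ (Counting.parameter-relation _ srg) ⟩
    + (k ℕ.* k ℕ.+ mu ℕ.* (k ℕ.+ 1))       ≡⟨ ℕ→ℤ-relation k k mu k ⟩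
    + k * + k + + mu * (+ k + + 1)         ∎))
  where open ≡-Reasoning

hd≡H/μ : ∀ {v k d mu ρ σ} → let μ = + mu ; κ = μ - ρ * σ ; K = κ - σ ; H = (+ d - σ) * (κ - ρ) ; h = hd v k d σ in
  + k ≡ κ → K ≢ 0ℤ → μ * + v ≡ K * (κ - ρ) → ↥ h * μ ≡ H * ↧ h
hd≡H/μ {v} {k} {d} {mu} {ρ} {σ} k≡ K≢0 counting = cross-rescale {↥ h} {↧ h} {K} {N} {+ mu} {H} K≢0
  (subst (λ κ → ↥ h * (κ - σ) ≡ N * ↧ h) k≡ (↥÷′↧ N (+ k - σ) (subst (λ κ → κ - σ ≢ 0ℤ) (sym k≡) K≢0)))
  (μ[v[d-σ]]≡K*H counting)
  where
  open TypeIIBound (+ mu) ρ σ (+ v) (+ d) using (K; H; μ[v[d-σ]]≡K*H)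
  h : ℚ
  h = hd v k d σ
  N : ℤ
  N = + v * (+ d - σ)

Rab-below : ∀ {v k lam mu d r q} → 0ℤ < q → (∀ y → InS v k lam mu d y → + y < q) → IsRab v k lam mu d r → + r < q
Rab-below 0<q _   (inj₁ (_ , refl)) = 0<q
Rab-below _   S<q (inj₂ (r∈S , _))  = S<q _ r∈S

corollary6p14 : (v k lam mu : ℕ) (Γ : Graph v) → IsSRG Γ k lam mu → 0 ℕ.< mu →
    (ρ σ : ℤ) → IsRestrictedRoot k lam mu ρ → IsRestrictedRoot k lam mu σ → σ ℤ.< ρ →
    (d : ℕ) → d ℕ.≤ k →
    0ℚ ℚ.< frac (hd v k d σ) →
    frac (hd v k d σ) ℚ.< ((((+ k ℤ.- σ) ℤ.- (+ d ℤ.- σ) ℤ.* (ρ ℤ.- σ)) ℚ./ 1) ÷′ (+ mu ℚ./ 1)) →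
    (r : ℕ) → IsRab v k lam mu d r → + r ℤ.< ℚ.floor (hd v k d σ)
corollary6p14 v k′ lam′ mu Γ srg 0<mu ρ σ ρ-root σ-root σ<ρ d d≤k′ 0<frac frac<B/μ r =
  Rab-below 0<q (λ y → ∈S⇒<q ∘ ∈S y)
  where
  μ : ℤ
  μ = + mu
  open TypeIIBound μ ρ σ (+ v) (+ d)
  k≡ : + k′ ≡ k
  k≡ = proj₁ (restricted-eigenvalues ρ-root σ-root σ<ρ)
  lam≡ : + lam′ ≡ lam
  lam≡ = proj₂ (restricted-eigenvalues ρ-root σ-root σ<ρ)
  signs : σ < 0ℤ × 0ℤ ≤ ρ
  signs = eigenvalue-signs σ<ρ (subst (μ ≤_) k≡ (+≤+ (Counting.mu≤k Γ srg)))
                               (subst₂ _<_ lam≡ k≡ (+<+ (Counting.lam<k Γ srg)))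
  d≤k : + d ≤ k
  d≤k = subst (+ d ≤_) k≡ (+≤+ d≤k′)
  K≢0 : K ≢ 0ℤ
  K≢0 = ≢-sym (ℤP.<⇒≢ (ℤP.+-mono-≤-< (ℤP.≤-trans (+≤+ ℕ.z≤n) d≤k) (ℤP.neg-mono-< (proj₁ signs))))
  counting : μ * + v ≡ K * (k - ρ)
  counting = type-II-counting {ρ = ρ} {σ = σ} srg k≡ lam≡
  open FloorOfRatio (hd v k′ d σ) μ H (hd≡H/μ {v} {k′} {d} {mu} {ρ} {σ} k≡ K≢0 counting)
  open Bound (+<+ 0<mu) (proj₁ signs) (proj₂ signs) (+≤+ ℕ.z≤n) d≤k counting
    (0<frac⇒M⌊h⌋<H (+<+ 0<mu) 0<frac) (H<M[⌊h⌋+1] (+<+ 0<mu))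
    (frac<⇒H-M⌊h⌋< (+<+ 0<mu) _
      (subst (λ κ → frac (hd v k′ d σ) ℚ.< ((((κ - σ) - (+ d - σ) * (ρ - σ)) ℚ./ 1) ÷′ (μ ℚ./ 1))) k≡ frac<B/μ))
  ∈S : ∀ y → InS v k′ lam′ mu d y → InSℤ (+ y)
  ∈S y (d<y , y≤v , R≥0) =
    +<+ d<y , +≤+ y≤v , subst₂ (λ κ l → ∀ x → 0ℤ ≤ Rℤ (+ v) κ l μ x (+ y) (+ d)) k≡ lam≡ R≥0
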